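{- Let $\Gamma_4^3$ be the set of ordered triples $(i_1,i_2,i_3)$ of distinct elements of $[4]=\{1,2,3,4\}$ modulo cyclic rotation, the class of $(i_1,i_2,i_3)$ being written $(i_1i_2i_3)$, and let $-(i_1i_2i_3):=(i_3i_2i_1)$. Similarly let $\Gamma_4^2$ be the set of unordered pairs $(ij)=(ji)$ of distinct elements of $[4]$. For $\gamma=(ijk)\in\Gamma_4^3$ with $\{l\}=[4]\setminus\{i,j,k\}$, define $o_\gamma:\binom{[4]}{3}\to\Gamma_4^3$ by $o_\gamma(\{i,j,k\})=(ijk)$, $o_\gamma(\{i,j,l\})=(ijl)$, $o_\gamma(\{j,k,l\})=(jkl)$, $o_\gamma(\{k,i,l\})=(kil)$. For each $\alpha\in\Gamma_4^2$ let $\pi_\alpha:\Gamma_4^3\to\Gamma_4^3$ be the map determined by the rules $\pi_{(ij)}(ijk)=(jil)$ and $\pi_{(kl)}(ijk)=(ijl)$ for all distinct $i,j,k,l\in[4]$, and let $G$ be the permutation group of $\Gamma_4^3$ generated by all $\pi_\alpha$. Then: (a) every element of $G$ is an involution, $G$ is abelian, and $G$ acts transitively on $\Gamma_4^3$; (b) for $l\in[4]$, let $H_l$ be the subgroup of $G$ generated by $\pi_{(il)}$ for $i\in[4]\setminus\{l\}$; for distinct $i,j,k\in[4]\setminus\{l\}$, the set $\Gamma_4^3(ijk):=\{\gamma\in\Gamma_4^3: o_\gamma(\{i,j,k\})=(ijk)\}$ is an orbit of $H_l$. -}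

module Defs where

open import Data.Fin using (Fin)
open import Data.Fin.Subset using (Subset; ⁅_⁆; _∪_)
open import Data.Product using (Σ; ∃; _×_; _,_; proj₁)
open import Data.Sum using (_⊎_)
open import Function using (id; _∘_)
open import Relation.Binary.PropositionalEquality using (_≡_; _≢_)

Raw : Set
Raw = Fin 4 × Fin 4 × Fin 4

_∼ʳ_ : Raw → Raw → Set
(x , y , z) ∼ʳ t = (t ≡ (x , y , z)) ⊎ (t ≡ (y , z , x)) ⊎ (t ≡ (z , x , y))

-- Representatives of Γ₄³: ordered triples of distinct elements of [4]
record Triple : Set where
  constructor triple
  field
    a b c : Fin 4
    a≢b : a ≢ b
    b≢c : b ≢ c
    a≢c : a ≢ c

raw : Triple → Raw
raw γ = Triple.a γ , Triple.b γ , Triple.c γ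

_∼_ : Triple → Triple → Set
γ ∼ δ = raw γ ∼ʳ raw δ

Distinct4 : Fin 4 → Fin 4 → Fin 4 → Fin 4 → Set
Distinct4 i j k l =
  (i ≢ j) × (i ≢ k) × (i ≢ l) × (j ≢ k) × (j ≢ l) × (k ≢ l)

-- A family of maps π (i , j) : Γ₄³ → Γ₄³ indexed by α = (ij) ∈ Γ₄² satisfying
-- the defining rules of the paper (values for i ≡ j are irrelevant and unused):
--   * each π i j is a well-defined map on Γ₄³ (respects cyclic rotation),
--   * π depends only on the unordered pair (ij) = (ji),
--   * π_(ij)(ijk) = (jil) and π_(kl)(ijk) = (ijl) for distinct i j k l.
record IsPiFamily (π : Fin 4 → Fin 4 → Triple → Triple) : Set where
  field
    respects : ∀ i j → i ≢ j → ∀ γ δ → γ ∼ δ → π i j γ ∼ π i j δ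
    symmetric : ∀ i j → i ≢ j → ∀ γ → π i j γ ∼ π j i γ
    rule₁ : ∀ i j k l → Distinct4 i j k l → ∀ γ → raw γ ≡ (i , j , k) →
            raw (π i j γ) ∼ʳ (j , i , l)
    rule₂ : ∀ i j k l → Distinct4 i j k l → ∀ γ → raw γ ≡ (i , j , k) →
            raw (π k l γ) ∼ʳ (i , j , l)

-- Elements of Sym(Γ₄³) are represented by ∼-respecting maps on representatives,
-- taken up to pointwise ∼ (closure constructor 'ext').
data Gen {I : Set} (g : I → Triple → Triple) : (Triple → Triple) → Set where
  gen  : ∀ i → Gen g (g i)
  idG  : Gen g id
  comp : ∀ {f h} → Gen g f → Gen g h → Gen g (f ∘ h)
  inv  : ∀ {f h} → Gen g f → (∀ x y → x ∼ y → h x ∼ h y) →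
         (∀ x → h (f x) ∼ x) → (∀ x → f (h x) ∼ x) → Gen g h
  ext  : ∀ {f h} → Gen g f → (∀ x → f x ∼ h x) → Gen g h

-- Γ₄²: pairs of distinct elements (ordered representatives of (ij) = (ji))
Pair : Set
Pair = Σ (Fin 4 × Fin 4) (λ p → proj₁ p ≢ Data.Product.proj₂ p)

G : (Fin 4 → Fin 4 → Triple → Triple) → (Triple → Triple) → Set
G π = Gen {Pair} (λ { ((i , j) , _) → π i j })

H : (Fin 4 → Fin 4 → Triple → Triple) → Fin 4 → (Triple → Triple) → Set
H π l = Gen {Σ (Fin 4) (λ i → i ≢ l)} (λ { (i , _) → π i l })

set3 : Fin 4 → Fin 4 → Fin 4 → Subset 4
set3 x y z = ⁅ x ⁆ ∪ ⁅ y ⁆ ∪ ⁅ z ⁆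

O : Triple → Subset 4 → Raw → Set
O γ S t = ∃ λ d → (d ≢ a) × (d ≢ b) × (d ≢ c) ×
  (  ((S ≡ set3 a b c) × (t ≡ (a , b , c)))
   ⊎ ((S ≡ set3 a b d) × (t ≡ (a , b , d)))
   ⊎ ((S ≡ set3 b c d) × (t ≡ (b , c , d)))
   ⊎ ((S ≡ set3 c a d) × (t ≡ (c , a , d))))
  where
  open Triple γ

InΓ : Fin 4 → Fin 4 → Fin 4 → Triple → Set
InΓ i j k γ = ∃ λ t → O γ (set3 i j k) t × (t ∼ʳ (i , j , k))

IsOrbit : ((Triple → Triple) → Set) → (Triple → Set) → Set
IsOrbit K P =
  (∃ λ γ → P γ) ×
  (∀ γ δ → P γ → (P δ → ∃ λ f → K f × (f γ ∼ δ)) × ((∃ λ f → K f × (f γ ∼ δ)) → P δ))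

Claims : (Fin 4 → Fin 4 → Triple → Triple) → Set
Claims π =
  ((∀ f → G π f → ∀ γ → f (f γ) ∼ γ) ×
   (∀ f h → G π f → G π h → ∀ γ → f (h γ) ∼ h (f γ)) ×
   (∀ γ δ → ∃ λ f → G π f × (f γ ∼ δ))) ×
  (∀ l i j k → Distinct4 i j k l → IsOrbit (H π l) (InΓ i j k))

-- Γ₄³ has eight elements. Choosing a representative of each class identifies Γ₄³ with
-- 𝔽₂³ (code), and in these coordinates the defining rules leave π_(ij) no freedom: some
-- rotation of every triple is one to which a rule applies, and every rule adds the same
-- vector translation i j; conversely, adding these vectors satisfies all the rules. Hence G
-- is a group of translations of 𝔽₂³, so its elements are involutions and commute, and it is
-- transitive because the translation vectors span 𝔽₂³. The vectors translation m l (m ≠ l)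
-- span the kernel of a linear form φ l, and Γ₄³(ijk) is a fibre of φ l ∘ code, i.e. a coset
-- of that kernel, which is exactly an H_l-orbit.

module Submission where

open import Defs
open import Data.Bool using (Bool; true; false; _xor_)
open import Data.Bool.Properties using (xor-assoc; xor-comm; xor-same)
import Data.Bool.Properties as Bool
open import Data.Fin using (Fin)
open import Data.Fin.Patterns using (0F; 1F; 2F; 3F)
open import Data.Fin.Properties using (_≟_; all?; any?)
open import Data.Fin.Subset using (Subset; ⁅_⁆; _∪_)
open import Data.Fin.Subset.Properties using (anySubset?; ∪-assoc; ∪-comm)
open import Data.List using (List; []; _∷_; map)
open import Data.Product using (Σ; ∃; _×_; _,_; proj₁; proj₂; swap)
import Data.Product.Properties as Product
open import Data.Sum using (_⊎_; inj₁; inj₂; [_,_])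
open import Data.Unit using (⊤; tt)
open import Data.Vec using (Vec; []; _∷_; zipWith; replicate)
import Data.Vec.Properties as Vec
open import Function using (id; _∘_)
open import Relation.Binary.Definitions using (Decidable; DecidableEquality)
open import Relation.Binary.PropositionalEquality
  using (_≡_; _≢_; refl; sym; trans; cong; cong₂; subst; ≢-sym; module ≡-Reasoning)
open import Relation.Nullary.Decidable
  using (Dec; yes; no; map′; ¬?; _×-dec_; _⊎-dec_; _→-dec_; from-yes; decidable-stable)

𝔽₂³ : Set
𝔽₂³ = Vec Bool 3

infixr 6 _⊕_

_⊕_ : 𝔽₂³ → 𝔽₂³ → 𝔽₂³
_⊕_ = zipWith _xor_

𝟘 : 𝔽₂³
𝟘 = replicate 3 false

infix 4 _≟ᵛ_ _≟ʳ_

_≟ᵛ_ : DecidableEquality 𝔽₂³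
_≟ᵛ_ = Vec.≡-dec Bool._≟_

⊕-assoc : ∀ u v w → (u ⊕ v) ⊕ w ≡ u ⊕ (v ⊕ w)
⊕-assoc = Vec.zipWith-assoc xor-assoc

⊕-comm : ∀ u v → u ⊕ v ≡ v ⊕ u
⊕-comm = Vec.zipWith-comm xor-comm

⊕-identityˡ : ∀ u → 𝟘 ⊕ u ≡ u
⊕-identityˡ = Vec.zipWith-identityˡ (λ _ → refl)

⊕-self : ∀ {n} (u : Vec Bool n) → zipWith _xor_ u u ≡ replicate n false
⊕-self []      = refl
⊕-self (x ∷ u) = cong₂ _∷_ (xor-same x) (⊕-self u)

⊕-cancelˡ : ∀ u v → u ⊕ (u ⊕ v) ≡ v
⊕-cancelˡ u v = begin
  u ⊕ (u ⊕ v) ≡⟨ ⊕-assoc u u v ⟨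
  (u ⊕ u) ⊕ v ≡⟨ cong (_⊕ v) (⊕-self u) ⟩
  𝟘 ⊕ v       ≡⟨ ⊕-identityˡ v ⟩
  v           ∎
  where open ≡-Reasoning

all𝔽₂³? : {P : 𝔽₂³ → Set} → (∀ u → Dec (P u)) → Dec (∀ u → P u)
all𝔽₂³? P? = map′ (λ ¬∃¬P u → decidable-stable (P? u) (λ ¬Pu → ¬∃¬P (u , ¬Pu)))
                  (λ ∀P (u , ¬Pu) → ¬Pu (∀P u))
                  (¬? (anySubset? (¬? ∘ P?)))

∼ʳ-refl : ∀ r → r ∼ʳ r
∼ʳ-refl r = inj₁ refl

∼ʳ-sym : ∀ {r s} → r ∼ʳ s → s ∼ʳ r
∼ʳ-sym (inj₁ refl)        = inj₁ refl
∼ʳ-sym (inj₂ (inj₁ refl)) = inj₂ (inj₂ refl)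
∼ʳ-sym (inj₂ (inj₂ refl)) = inj₂ (inj₁ refl)

∼ʳ-trans : ∀ {r s t} → r ∼ʳ s → s ∼ʳ t → r ∼ʳ t
∼ʳ-trans (inj₁ refl)        q                  = q
∼ʳ-trans (inj₂ (inj₁ refl)) (inj₁ refl)        = inj₂ (inj₁ refl)
∼ʳ-trans (inj₂ (inj₁ refl)) (inj₂ (inj₁ refl)) = inj₂ (inj₂ refl)
∼ʳ-trans (inj₂ (inj₁ refl)) (inj₂ (inj₂ refl)) = inj₁ refl
∼ʳ-trans (inj₂ (inj₂ refl)) (inj₁ refl)        = inj₂ (inj₂ refl)
∼ʳ-trans (inj₂ (inj₂ refl)) (inj₂ (inj₁ refl)) = inj₁ refl
∼ʳ-trans (inj₂ (inj₂ refl)) (inj₂ (inj₂ refl)) = inj₂ (inj₁ refl)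

_≟ʳ_ : DecidableEquality Raw
_≟ʳ_ = Product.≡-dec _≟_ (Product.≡-dec _≟_ _≟_)

_∼ʳ?_ : Decidable _∼ʳ_
(x , y , z) ∼ʳ? t = t ≟ʳ (x , y , z) ⊎-dec t ≟ʳ (y , z , x) ⊎-dec t ≟ʳ (z , x , y)

Distinct4? : ∀ i j k l → Dec (Distinct4 i j k l)
Distinct4? i j k l =
  ¬? (i ≟ j) ×-dec ¬? (i ≟ k) ×-dec ¬? (i ≟ l) ×-dec ¬? (j ≟ k) ×-dec ¬? (j ≟ l) ×-dec ¬? (k ≟ l)

representative : 𝔽₂³ → Triple
representative (false ∷ false ∷ false ∷ []) = triple 0F 1F 2F (λ ()) (λ ()) (λ ())
representative (false ∷ false ∷ true  ∷ []) = triple 0F 1F 3F (λ ()) (λ ()) (λ ())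
representative (false ∷ true  ∷ false ∷ []) = triple 0F 2F 3F (λ ()) (λ ()) (λ ())
representative (false ∷ true  ∷ true  ∷ []) = triple 1F 3F 2F (λ ()) (λ ()) (λ ())
representative (true  ∷ false ∷ false ∷ []) = triple 0F 3F 1F (λ ()) (λ ()) (λ ())
representative (true  ∷ false ∷ true  ∷ []) = triple 0F 2F 1F (λ ()) (λ ()) (λ ())
representative (true  ∷ true  ∷ false ∷ []) = triple 1F 2F 3F (λ ()) (λ ()) (λ ())
representative (true  ∷ true  ∷ true  ∷ []) = triple 0F 3F 2F (λ ()) (λ ()) (λ ())

-- Triples with a repeated entry get the junk code 𝟘.
codeʳ : Raw → 𝔽₂³
codeʳ r with anySubset? (λ v → raw (representative v) ∼ʳ? r)
... | yes (v , _) = v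
... | no _        = 𝟘

code : Triple → 𝔽₂³
code γ = codeʳ (raw γ)

-- Facts proved by exhaustive evaluation are kept opaque, so that the typechecker never
-- unfolds the evaluation when they are used.
opaque
  codeʳ-rotate : ∀ a b c → codeʳ (a , b , c) ≡ codeʳ (b , c , a)
  codeʳ-rotate = from-yes (all? λ a → all? λ b → all? λ c → codeʳ (a , b , c) ≟ᵛ codeʳ (b , c , a))

codeʳ-resp : ∀ {r s} → r ∼ʳ s → codeʳ r ≡ codeʳ s
codeʳ-resp {x , y , z} (inj₁ refl)        = refl
codeʳ-resp {x , y , z} (inj₂ (inj₁ refl)) = codeʳ-rotate x y z
codeʳ-resp {x , y , z} (inj₂ (inj₂ refl)) = sym (codeʳ-rotate z x y)

code-resp : ∀ γ δ → γ ∼ δ → code γ ≡ code δ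
code-resp γ δ = codeʳ-resp

opaque
  rotation-representative : ∀ a b c → a ≢ b → b ≢ c → a ≢ c →
                            (a , b , c) ∼ʳ raw (representative (codeʳ (a , b , c)))
  rotation-representative = from-yes (all? λ a → all? λ b → all? λ c →
    ¬? (a ≟ b) →-dec ¬? (b ≟ c) →-dec ¬? (a ≟ c) →-dec
    (a , b , c) ∼ʳ? raw (representative (codeʳ (a , b , c))))

∼-representative : ∀ γ → γ ∼ representative (code γ)
∼-representative (triple a b c a≢b b≢c a≢c) = rotation-representative a b c a≢b b≢c a≢c

code-injective : ∀ γ δ → code γ ≡ code δ → γ ∼ δ
code-injective γ δ eq = ∼ʳ-trans (∼-representative γ)
  (subst (λ v → raw (representative v) ∼ʳ raw δ) (sym eq) (∼ʳ-sym (∼-representative δ)))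

translation : Fin 4 → Fin 4 → 𝔽₂³
translation 0F 0F = false ∷ false ∷ false ∷ []
translation 0F 1F = true  ∷ false ∷ false ∷ []
translation 0F 2F = false ∷ true  ∷ false ∷ []
translation 0F 3F = true  ∷ true  ∷ false ∷ []
translation 1F 0F = true  ∷ false ∷ false ∷ []
translation 1F 1F = false ∷ false ∷ false ∷ []
translation 1F 2F = false ∷ true  ∷ true  ∷ []
translation 1F 3F = true  ∷ true  ∷ true  ∷ []
translation 2F 0F = false ∷ true  ∷ false ∷ []
translation 2F 1F = false ∷ true  ∷ true  ∷ []
translation 2F 2F = false ∷ false ∷ false ∷ []
translation 2F 3F = false ∷ false ∷ true  ∷ []
translation 3F 0F = true  ∷ true  ∷ false ∷ []
translation 3F 1F = true  ∷ true  ∷ true  ∷ []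
translation 3F 2F = false ∷ false ∷ true  ∷ []
translation 3F 3F = false ∷ false ∷ false ∷ []

opaque
  translation-sym : ∀ i j → translation i j ≡ translation j i
  translation-sym = from-yes (all? λ i → all? λ j → translation i j ≟ᵛ translation j i)

opaque
  translation-rule₁ : ∀ i j k l → Distinct4 i j k l →
                      codeʳ (j , i , l) ≡ translation i j ⊕ codeʳ (i , j , k)
  translation-rule₁ = from-yes (all? λ i → all? λ j → all? λ k → all? λ l → Distinct4? i j k l →-dec
    codeʳ (j , i , l) ≟ᵛ translation i j ⊕ codeʳ (i , j , k))

opaque
  translation-rule₂ : ∀ i j k l → Distinct4 i j k l →
                      codeʳ (i , j , l) ≡ translation k l ⊕ codeʳ (i , j , k)
  translation-rule₂ = from-yes (all? λ i → all? λ j → all? λ k → all? λ l → Distinct4? i j k l →-dec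
    codeʳ (i , j , l) ≟ᵛ translation k l ⊕ codeʳ (i , j , k))

πᶜ : Fin 4 → Fin 4 → Triple → Triple
πᶜ i j γ = representative (translation i j ⊕ code γ)

representative-∼ʳ : ∀ {a b c} → a ≢ b → b ≢ c → a ≢ c → ∀ {v} → codeʳ (a , b , c) ≡ v →
                    raw (representative v) ∼ʳ (a , b , c)
representative-∼ʳ {a} {b} {c} a≢b b≢c a≢c refl = ∼ʳ-sym (rotation-representative a b c a≢b b≢c a≢c)

πᶜ-isPiFamily : IsPiFamily πᶜ
πᶜ-isPiFamily = record
  { respects = λ i j _ γ δ γ∼δ →
      subst (λ v → πᶜ i j γ ∼ representative (translation i j ⊕ v)) (code-resp γ δ γ∼δ) (∼ʳ-refl _)
  ; symmetric = λ i j _ γ →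
      subst (λ t → πᶜ i j γ ∼ representative (t ⊕ code γ)) (translation-sym i j) (∼ʳ-refl _)
  ; rule₁ = λ { i j k l D@(i≢j , _ , i≢l , _ , j≢l , _) γ γ≡ijk →
      representative-∼ʳ (≢-sym i≢j) i≢l j≢l
        (trans (translation-rule₁ i j k l D) (cong (λ r → translation i j ⊕ codeʳ r) (sym γ≡ijk))) }
  ; rule₂ = λ { i j k l D@(i≢j , _ , i≢l , _ , j≢l , _) γ γ≡ijk →
      representative-∼ʳ i≢j j≢l i≢l
        (trans (translation-rule₂ i j k l D) (cong (λ r → translation k l ⊕ codeʳ r) (sym γ≡ijk))) }
  }

-- The four ways a rule determines π_(ij) on r: rule₁ for π_(ij) or (via symmetric) for
-- π_(ji), and rule₂ for π_(ij) or for π_(ji).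
RuleApplies : Fin 4 → Fin 4 → Raw → Set
RuleApplies i j r = ∃ λ k → ∃ λ l →
    (Distinct4 i j k l × r ≡ (i , j , k))
  ⊎ (Distinct4 j i k l × r ≡ (j , i , k))
  ⊎ (Distinct4 k l i j × r ≡ (k , l , i))
  ⊎ (Distinct4 k l j i × r ≡ (k , l , j))

RuleApplies? : ∀ i j r → Dec (RuleApplies i j r)
RuleApplies? i j r = any? λ k → any? λ l →
     (Distinct4? i j k l ×-dec r ≟ʳ (i , j , k))
  ⊎-dec (Distinct4? j i k l ×-dec r ≟ʳ (j , i , k))
  ⊎-dec (Distinct4? k l i j ×-dec r ≟ʳ (k , l , i))
  ⊎-dec (Distinct4? k l j i ×-dec r ≟ʳ (k , l , j))

rotate : Triple → Triple
rotate (triple a b c a≢b b≢c a≢c) = triple b c a b≢c (≢-sym a≢c) (≢-sym a≢b)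

opaque
  some-rotation-RuleApplies : ∀ i j → i ≢ j → ∀ a b c → a ≢ b → b ≢ c → a ≢ c →
    RuleApplies i j (a , b , c) ⊎ RuleApplies i j (b , c , a) ⊎ RuleApplies i j (c , a , b)
  some-rotation-RuleApplies = from-yes (all? λ i → all? λ j → ¬? (i ≟ j) →-dec
    all? λ a → all? λ b → all? λ c → ¬? (a ≟ b) →-dec ¬? (b ≟ c) →-dec ¬? (a ≟ c) →-dec
    (RuleApplies? i j (a , b , c) ⊎-dec RuleApplies? i j (b , c , a) ⊎-dec RuleApplies? i j (c , a , b)))

record IsTranslation (f : Triple → Triple) (u : 𝔽₂³) : Set where
  constructor translation-by
  field
    shifts : ∀ γ → code (f γ) ≡ u ⊕ code γ

open IsTranslation

record IsSubspace (S : 𝔽₂³ → Set) : Set where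
  field
    𝟘∈     : S 𝟘
    ⊕-closed : ∀ {u v} → S u → S v → S (u ⊕ v)

translation-id : IsTranslation id 𝟘
translation-id = translation-by λ γ → sym (⊕-identityˡ (code γ))

translation-∘ : ∀ {f h u v} → IsTranslation f u → IsTranslation h v → IsTranslation (f ∘ h) (u ⊕ v)
translation-∘ {f} {h} {u} {v} f-u h-v = translation-by λ γ → begin
  code (f (h γ))    ≡⟨ shifts f-u (h γ) ⟩
  u ⊕ code (h γ)    ≡⟨ cong (u ⊕_) (shifts h-v γ) ⟩
  u ⊕ (v ⊕ code γ)  ≡⟨ ⊕-assoc u v (code γ) ⟨
  (u ⊕ v) ⊕ code γ  ∎
  where open ≡-Reasoning

translation-inverse : ∀ {f h u} → IsTranslation f u → (∀ γ → f (h γ) ∼ γ) → IsTranslation h u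
translation-inverse {f} {h} {u} f-u fh∼id = translation-by λ γ → begin
  code (h γ)           ≡⟨ ⊕-cancelˡ u (code (h γ)) ⟨
  u ⊕ (u ⊕ code (h γ)) ≡⟨ cong (u ⊕_) (shifts f-u (h γ)) ⟨
  u ⊕ code (f (h γ))   ≡⟨ cong (u ⊕_) (code-resp (f (h γ)) γ (fh∼id γ)) ⟩
  u ⊕ code γ           ∎
  where open ≡-Reasoning

translation-cong : ∀ {f h u} → IsTranslation f u → (∀ γ → f γ ∼ h γ) → IsTranslation h u
translation-cong {f} {h} f-u f∼h = translation-by λ γ →
  trans (sym (code-resp (f γ) (h γ) (f∼h γ))) (shifts f-u γ)

Gen-translation : ∀ {I : Set} {g : I → Triple → Triple} {S} → IsSubspace S →
                  (∀ i → ∃ λ u → S u × IsTranslation (g i) u) →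
                  ∀ {f} → Gen g f → ∃ λ u → S u × IsTranslation f u
Gen-translation {g = g} {S} S-subspace g-translation = go
  where
  open IsSubspace S-subspace
  go : ∀ {f} → Gen g f → ∃ λ u → S u × IsTranslation f u
  go (gen i)              = g-translation i
  go idG                  = 𝟘 , 𝟘∈ , translation-id
  go (comp f∈ h∈) =
    let u , u∈ , f-u = go f∈
        v , v∈ , h-v = go h∈
    in u ⊕ v , ⊕-closed u∈ v∈ , translation-∘ f-u h-v
  go (inv f∈ _ _ fh∼id) = let u , u∈ , f-u = go f∈ in u , u∈ , translation-inverse f-u fh∼id
  go (ext f∈ f∼h)       = let u , u∈ , f-u = go f∈ in u , u∈ , translation-cong f-u f∼h

-- Span vs u: u is the sum of some sublist of vs.
Span : List 𝔽₂³ → 𝔽₂³ → Set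
Span []       u = u ≡ 𝟘
Span (v ∷ vs) u = Span vs u ⊎ Span vs (v ⊕ u)

Span? : ∀ vs u → Dec (Span vs u)
Span? []       u = u ≟ᵛ 𝟘
Span? (v ∷ vs) u = Span? vs u ⊎-dec Span? vs (v ⊕ u)

Gen-realises-Span : ∀ {I : Set} {g : I → Triple → Triple} (vec : I → 𝔽₂³) →
                    (∀ i → IsTranslation (g i) (vec i)) →
                    ∀ is {u} → Span (map vec is) u → ∃ λ f → Gen g f × IsTranslation f u
Gen-realises-Span vec g-translation []       refl       = id , idG , translation-id
Gen-realises-Span vec g-translation (i ∷ is) (inj₁ u∈)  = Gen-realises-Span vec g-translation is u∈
Gen-realises-Span {g = g} vec g-translation (i ∷ is) {u} (inj₂ iu∈) =
  let f , f∈ , f-iu = Gen-realises-Span vec g-translation is iu∈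
  in g i ∘ f , comp (gen i) f∈
   , subst (IsTranslation (g i ∘ f)) (⊕-cancelˡ (vec i) u) (translation-∘ (g-translation i) f-iu)

translation-involutive : ∀ {f u} → IsTranslation f u → ∀ γ → f (f γ) ∼ γ
translation-involutive {f} {u} f-u γ = code-injective (f (f γ)) γ (begin
  code (f (f γ))       ≡⟨ shifts f-u (f γ) ⟩
  u ⊕ code (f γ)       ≡⟨ cong (u ⊕_) (shifts f-u γ) ⟩
  u ⊕ (u ⊕ code γ)     ≡⟨ ⊕-cancelˡ u (code γ) ⟩
  code γ               ∎)
  where open ≡-Reasoning

translations-commute : ∀ {f h u v} → IsTranslation f u → IsTranslation h v → ∀ γ → f (h γ) ∼ h (f γ)
translations-commute {f} {h} {u} {v} f-u h-v γ = code-injective (f (h γ)) (h (f γ)) (begin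
  code (f (h γ))     ≡⟨ shifts (translation-∘ f-u h-v) γ ⟩
  (u ⊕ v) ⊕ code γ   ≡⟨ cong (_⊕ code γ) (⊕-comm u v) ⟩
  (v ⊕ u) ⊕ code γ   ≡⟨ shifts (translation-∘ h-v f-u) γ ⟨
  code (h (f γ))     ∎)
  where open ≡-Reasoning

translation-moves : ∀ {f} γ δ → IsTranslation f (code γ ⊕ code δ) → f γ ∼ δ
translation-moves {f} γ δ f-γδ = code-injective (f γ) δ (begin
  code (f γ)                   ≡⟨ shifts f-γδ γ ⟩
  (code γ ⊕ code δ) ⊕ code γ   ≡⟨ ⊕-comm (code γ ⊕ code δ) (code γ) ⟩
  code γ ⊕ (code γ ⊕ code δ)   ≡⟨ ⊕-cancelˡ (code γ) (code δ) ⟩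
  code δ                       ∎)
  where open ≡-Reasoning

-- φ l is the linear form whose kernel is spanned by the vectors translation m l, m ≠ l.
φ : Fin 4 → 𝔽₂³ → Bool
φ 0F (x ∷ y ∷ z ∷ []) = z
φ 1F (x ∷ y ∷ z ∷ []) = y xor z
φ 2F (x ∷ y ∷ z ∷ []) = x
φ 3F (x ∷ y ∷ z ∷ []) = x xor y

Ker : Fin 4 → 𝔽₂³ → Set
Ker l u = φ l u ≡ false

opaque
  φ-⊕ : ∀ l u v → φ l (u ⊕ v) ≡ φ l u xor φ l v
  φ-⊕ = from-yes (all? λ l → all𝔽₂³? λ u → all𝔽₂³? λ v → φ l (u ⊕ v) Bool.≟ φ l u xor φ l v)

Ker-isSubspace : ∀ l → IsSubspace (Ker l)
Ker-isSubspace l = record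
  { 𝟘∈     = trans (φ-⊕ l 𝟘 𝟘) (xor-same (φ l 𝟘))
  ; ⊕-closed = λ {u} {v} u∈ v∈ → trans (φ-⊕ l u v) (cong₂ _xor_ u∈ v∈)
  }

φ-translate : ∀ l {u} → Ker l u → ∀ v → φ l (u ⊕ v) ≡ φ l v
φ-translate l {u} u∈ v = trans (φ-⊕ l u v) (cong (_xor φ l v) u∈)

Ker-difference : ∀ l {u v} → φ l u ≡ φ l v → Ker l (u ⊕ v)
Ker-difference l {u} {v} eq = trans (φ-⊕ l u v) (trans (cong (_xor φ l v) eq) (xor-same (φ l v)))

opaque
  translation∈Ker : ∀ m l → Ker l (translation m l)
  translation∈Ker = from-yes (all? λ m → all? λ l → φ l (translation m l) Bool.≟ false)

H-generators : (l : Fin 4) → List (Σ (Fin 4) (_≢ l))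
H-generators 0F = (1F , λ ()) ∷ (2F , λ ()) ∷ []
H-generators 1F = (0F , λ ()) ∷ (2F , λ ()) ∷ []
H-generators 2F = (0F , λ ()) ∷ (1F , λ ()) ∷ []
H-generators 3F = (0F , λ ()) ∷ (1F , λ ()) ∷ []

H-generator-translation : (l : Fin 4) → Σ (Fin 4) (_≢ l) → 𝔽₂³
H-generator-translation l (m , _) = translation m l

opaque
  Ker-spanned-by-H-generators : ∀ l u → Ker l u → Span (map (H-generator-translation l) (H-generators l)) u
  Ker-spanned-by-H-generators = from-yes (all? λ l → all𝔽₂³? λ u → φ l u Bool.≟ false →-dec
    Span? (map (H-generator-translation l) (H-generators l)) u)

G-generators : List Pair
G-generators = ((0F , 1F) , λ ()) ∷ ((0F , 2F) , λ ()) ∷ ((2F , 3F) , λ ()) ∷ []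

G-generator-translation : Pair → 𝔽₂³
G-generator-translation ((i , j) , _) = translation i j

opaque
  G-generators-span : ∀ u → Span (map G-generator-translation G-generators) u
  G-generators-span = from-yes (all𝔽₂³? (Span? (map G-generator-translation G-generators)))

set3-rotate : ∀ a b c → set3 a b c ≡ set3 b c a
set3-rotate a b c = trans (∪-comm ⁅ a ⁆ (⁅ b ⁆ ∪ ⁅ c ⁆)) (∪-assoc ⁅ b ⁆ ⁅ c ⁆ ⁅ a ⁆)

InΓ-rotate : ∀ {i j k} γ → InΓ i j k γ → InΓ i j k (rotate γ)
InΓ-rotate (triple a b c _ _ _) (t , (d , d≢a , d≢b , d≢c , o) , t∼ijk) with o
... | inj₁ (S≡abc , refl) =
  (b , c , a) , (d , d≢b , d≢c , d≢a , inj₁ (trans S≡abc (set3-rotate a b c) , refl)) , ∼ʳ-trans (inj₂ (inj₂ refl)) t∼ijk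
... | inj₂ (inj₁ abd)        = t , (d , d≢b , d≢c , d≢a , inj₂ (inj₂ (inj₂ abd))) , t∼ijk
... | inj₂ (inj₂ (inj₁ bcd)) = t , (d , d≢b , d≢c , d≢a , inj₂ (inj₁ bcd)) , t∼ijk
... | inj₂ (inj₂ (inj₂ cad)) = t , (d , d≢b , d≢c , d≢a , inj₂ (inj₂ (inj₁ cad))) , t∼ijk

InΓ-resp : ∀ {i j k} γ δ → γ ∼ δ → InΓ i j k γ → InΓ i j k δ
InΓ-resp (triple _ _ _ _ _ _) (triple _ _ _ _ _ _) (inj₁ refl) γ∈ = γ∈
InΓ-resp γ@(triple _ _ _ _ _ _) (triple _ _ _ _ _ _) (inj₂ (inj₁ refl)) γ∈ = InΓ-rotate γ γ∈
InΓ-resp γ@(triple _ _ _ _ _ _) (triple _ _ _ _ _ _) (inj₂ (inj₂ refl)) γ∈ = InΓ-rotate (rotate γ) (InΓ-rotate γ γ∈)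

∃Raw? : {P : Raw → Set} → (∀ r → Dec (P r)) → Dec (∃ P)
∃Raw? P? = map′ (λ (a , b , c , p) → (a , b , c) , p) (λ ((a , b , c) , p) → a , b , c , p)
                (any? λ a → any? λ b → any? λ c → P? (a , b , c))

infix 4 _≟ˢ_

_≟ˢ_ : DecidableEquality (Subset 4)
_≟ˢ_ = Vec.≡-dec Bool._≟_

O? : ∀ γ S t → Dec (O γ S t)
O? (triple a b c _ _ _) S t = any? λ d → ¬? (d ≟ a) ×-dec ¬? (d ≟ b) ×-dec ¬? (d ≟ c) ×-dec
  (      (S ≟ˢ set3 a b c ×-dec t ≟ʳ (a , b , c))
   ⊎-dec (S ≟ˢ set3 a b d ×-dec t ≟ʳ (a , b , d))
   ⊎-dec (S ≟ˢ set3 b c d ×-dec t ≟ʳ (b , c , d))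
   ⊎-dec (S ≟ˢ set3 c a d ×-dec t ≟ʳ (c , a , d)))

-- The rotation test comes first: it discards all but three candidates t cheaply.
InΓ? : ∀ i j k γ → Dec (InΓ i j k γ)
InΓ? i j k γ = ∃Raw? λ t → map′ swap swap (t ∼ʳ? (i , j , k) ×-dec O? γ (set3 i j k) t)

opaque
  InΓ-representative⇔fibre : ∀ i j k l → Distinct4 i j k l → ∀ v →
    (InΓ i j k (representative v) → φ l v ≡ φ l (codeʳ (i , j , k))) ×
    (φ l v ≡ φ l (codeʳ (i , j , k)) → InΓ i j k (representative v))
  InΓ-representative⇔fibre = from-yes (all? λ i → all? λ j → all? λ k → all? λ l → Distinct4? i j k l →-dec
    all𝔽₂³? λ v → (InΓ? i j k (representative v) →-dec φ l v Bool.≟ φ l (codeʳ (i , j , k)))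
             ×-dec (φ l v Bool.≟ φ l (codeʳ (i , j , k)) →-dec InΓ? i j k (representative v)))

InΓ⇒fibre : ∀ {i j k l} → Distinct4 i j k l → ∀ γ → InΓ i j k γ → φ l (code γ) ≡ φ l (codeʳ (i , j , k))
InΓ⇒fibre D γ γ∈ = proj₁ (InΓ-representative⇔fibre _ _ _ _ D (code γ))
  (InΓ-resp γ (representative (code γ)) (∼-representative γ) γ∈)

fibre⇒InΓ : ∀ {i j k l} → Distinct4 i j k l → ∀ γ → φ l (code γ) ≡ φ l (codeʳ (i , j , k)) → InΓ i j k γ
fibre⇒InΓ D γ eq = InΓ-resp (representative (code γ)) γ (∼ʳ-sym (∼-representative γ))
  (proj₂ (InΓ-representative⇔fibre _ _ _ _ D (code γ)) eq)

module PiFamily {π : Fin 4 → Fin 4 → Triple → Triple} (isPi : IsPiFamily π) where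
  open IsPiFamily isPi
  open ≡-Reasoning

  π-shifts-RuleApplies : ∀ {i j} → i ≢ j → ∀ γ → RuleApplies i j (raw γ) →
                            code (π i j γ) ≡ translation i j ⊕ code γ
  π-shifts-RuleApplies {i} {j} i≢j γ (k , l , inj₁ (D , γ≡ijk)) = begin
    code (π i j γ)                      ≡⟨ codeʳ-resp (rule₁ i j k l D γ γ≡ijk) ⟩
    codeʳ (j , i , l)                   ≡⟨ translation-rule₁ i j k l D ⟩
    translation i j ⊕ codeʳ (i , j , k) ≡⟨ cong (λ r → translation i j ⊕ codeʳ r) γ≡ijk ⟨
    translation i j ⊕ code γ            ∎
  π-shifts-RuleApplies {i} {j} i≢j γ (k , l , inj₂ (inj₁ (D , γ≡jik))) = begin
    code (π i j γ)                      ≡⟨ code-resp (π i j γ) (π j i γ) (symmetric i j i≢j γ) ⟩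
    code (π j i γ)                      ≡⟨ codeʳ-resp (rule₁ j i k l D γ γ≡jik) ⟩
    codeʳ (i , j , l)                   ≡⟨ translation-rule₁ j i k l D ⟩
    translation j i ⊕ codeʳ (j , i , k) ≡⟨ cong₂ (λ t r → t ⊕ codeʳ r) (translation-sym i j) γ≡jik ⟨
    translation i j ⊕ code γ            ∎
  π-shifts-RuleApplies {i} {j} i≢j γ (k , l , inj₂ (inj₂ (inj₁ (D , γ≡kli)))) = begin
    code (π i j γ)                      ≡⟨ codeʳ-resp (rule₂ k l i j D γ γ≡kli) ⟩
    codeʳ (k , l , j)                   ≡⟨ translation-rule₂ k l i j D ⟩
    translation i j ⊕ codeʳ (k , l , i) ≡⟨ cong (λ r → translation i j ⊕ codeʳ r) γ≡kli ⟨
    translation i j ⊕ code γ            ∎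
  π-shifts-RuleApplies {i} {j} i≢j γ (k , l , inj₂ (inj₂ (inj₂ (D , γ≡klj)))) = begin
    code (π i j γ)                      ≡⟨ code-resp (π i j γ) (π j i γ) (symmetric i j i≢j γ) ⟩
    code (π j i γ)                      ≡⟨ codeʳ-resp (rule₂ k l j i D γ γ≡klj) ⟩
    codeʳ (k , l , i)                   ≡⟨ translation-rule₂ k l j i D ⟩
    translation j i ⊕ codeʳ (k , l , j) ≡⟨ cong₂ (λ t r → t ⊕ codeʳ r) (translation-sym i j) γ≡klj ⟨
    translation i j ⊕ code γ            ∎

  π-shifts : ∀ {i j} → i ≢ j → ∀ γ → code (π i j γ) ≡ translation i j ⊕ code γ
  π-shifts {i} {j} i≢j γ@(triple a b c a≢b b≢c a≢c) =
    [ π-shifts-RuleApplies i≢j γ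
    , [ via (rotate γ) (inj₂ (inj₁ refl)) , via (rotate (rotate γ)) (inj₂ (inj₂ refl)) ] ]
    (some-rotation-RuleApplies i j i≢j a b c a≢b b≢c a≢c)
    where
    via : ∀ δ → γ ∼ δ → RuleApplies i j (raw δ) → code (π i j γ) ≡ translation i j ⊕ code γ
    via δ γ∼δ src = begin
      code (π i j γ)           ≡⟨ code-resp (π i j γ) (π i j δ) (respects i j i≢j γ δ γ∼δ) ⟩
      code (π i j δ)           ≡⟨ π-shifts-RuleApplies i≢j δ src ⟩
      translation i j ⊕ code δ ≡⟨ cong (translation i j ⊕_) (code-resp γ δ γ∼δ) ⟨
      translation i j ⊕ code γ ∎

  π-translation : ∀ i j → i ≢ j → IsTranslation (π i j) (translation i j)
  π-translation i j i≢j = translation-by (π-shifts i≢j)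

  G-translation : ∀ {f} → G π f → ∃ λ u → IsTranslation f u
  G-translation f∈G =
    let u , _ , f-u = Gen-translation {S = λ _ → ⊤} (record { 𝟘∈ = tt ; ⊕-closed = λ _ _ → tt })
                        (λ { ((i , j) , i≢j) → translation i j , tt , π-translation i j i≢j }) f∈G
    in u , f-u

  G-realises : ∀ u → ∃ λ f → G π f × IsTranslation f u
  G-realises u = Gen-realises-Span G-generator-translation (λ { ((i , j) , i≢j) → π-translation i j i≢j })
                                   G-generators (G-generators-span u)

  H-translation : ∀ l {f} → H π l f → ∃ λ u → Ker l u × IsTranslation f u
  H-translation l = Gen-translation (Ker-isSubspace l)
    (λ { (m , m≢l) → translation m l , translation∈Ker m l , π-translation m l m≢l })

  H-realises : ∀ l u → Ker l u → ∃ λ f → H π l f × IsTranslation f u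
  H-realises l u u∈ = Gen-realises-Span (H-generator-translation l) (λ { (m , m≢l) → π-translation m l m≢l })
                                        (H-generators l) (Ker-spanned-by-H-generators l u u∈)

  InΓ-isOrbit : ∀ l i j k → Distinct4 i j k l → IsOrbit (H π l) (InΓ i j k)
  InΓ-isOrbit l i j k D@(i≢j , i≢k , i≢l , j≢k , j≢l , k≢l) =
    (ijk , ijk∈) , λ γ δ γ∈ → moves γ δ γ∈ , stays γ δ γ∈
    where
    ijk = triple i j k i≢j j≢k i≢k
    ijk∈ : InΓ i j k ijk
    ijk∈ = (i , j , k) , (l , ≢-sym i≢l , ≢-sym j≢l , ≢-sym k≢l , inj₁ (refl , refl)) , inj₁ refl
    moves : ∀ γ δ → InΓ i j k γ → InΓ i j k δ → ∃ λ f → H π l f × (f γ ∼ δ)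
    moves γ δ γ∈ δ∈ =
      let f , f∈H , f-γδ = H-realises l (code γ ⊕ code δ)
                             (Ker-difference l (trans (InΓ⇒fibre D γ γ∈) (sym (InΓ⇒fibre D δ δ∈))))
      in f , f∈H , translation-moves γ δ f-γδ
    stays : ∀ γ δ → InΓ i j k γ → (∃ λ f → H π l f × (f γ ∼ δ)) → InΓ i j k δ
    stays γ δ γ∈ (f , f∈H , fγ∼δ) =
      let u , u∈ , f-u = H-translation l f∈H
      in fibre⇒InΓ D δ (begin
        φ l (code δ)            ≡⟨ cong (φ l) (code-resp (f γ) δ fγ∼δ) ⟨
        φ l (code (f γ))        ≡⟨ cong (φ l) (shifts f-u γ) ⟩
        φ l (u ⊕ code γ)        ≡⟨ φ-translate l u∈ (code γ) ⟩
        φ l (code γ)            ≡⟨ InΓ⇒fibre D γ γ∈ ⟩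
        φ l (codeʳ (i , j , k)) ∎)

mainTheorem4 : (∃ λ π → IsPiFamily π) × (∀ π → IsPiFamily π → Claims π)
mainTheorem4 = (πᶜ , πᶜ-isPiFamily) , claims
  where
  claims : ∀ π → IsPiFamily π → Claims π
  claims π isPi = (involutive , commutative , transitive) , InΓ-isOrbit
    where
    open PiFamily isPi
    involutive : ∀ f → G π f → ∀ γ → f (f γ) ∼ γ
    involutive f f∈G = translation-involutive (proj₂ (G-translation f∈G))
    commutative : ∀ f h → G π f → G π h → ∀ γ → f (h γ) ∼ h (f γ)
    commutative f h f∈G h∈G = translations-commute (proj₂ (G-translation f∈G)) (proj₂ (G-translation h∈G))
    transitive : ∀ γ δ → ∃ λ f → G π f × (f γ ∼ δ)
    transitive γ δ = let f , f∈G , f-γδ = G-realises (code γ ⊕ code δ)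
                     in f , f∈G , translation-moves γ δ f-γδ
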